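{- In the setting described in the context, let $N$ be an even square, let $r\in\{1,3,5,7\}$ and suppose $B^2\equiv D+4rN\pmod{32N}$. Then $8\mid\theta$ if one of the following conditions holds: (a) $r=3$ or $r=7$, and $D\equiv1\pmod8$; (b) $r=1$ and $32\mid D$; (c) $r=5$ and $16\,\|\,D$. Moreover, in case (b): $4\,\|\,B$ if $4\,\|\,N$, and $8\mid B$ if $16\mid N$; in case (c): $4\,\|\,B$ if $16\mid N$, and $8\mid B$ if $4\,\|\,N$.
   Context: Setting: Let $N>1$ be an integer, $N=2^{\lambda(N)}N_1$ with $N_1$ odd. Let $D=c^2\Delta<0$ be a discriminant with fundamental part $\Delta$ and conductor $c$, $K=\mathbb Q(\sqrt D)$, $\mathcal O$ the order of discriminant $D$. Let $[A,B,C]$ be a primitive positive definite integral quadratic form with $B^2-4AC=D$, $\gcd(A,N)=1$ and $N\mid C$. Let $\alpha=\frac{ -B+\sqrt D}{2A}$, so $\mathcal O=\mathbb Z+\mathbb Z A\alpha$. Let $u,v\in\mathbb Z$ be such that $\pi=u+vA\alpha$ has norm $p=u^2-uvB+v^2AC$ a prime number not dividing $6cN$ that splits in $\mathcal O$, and assume $p\mid C$ and $p\mid u$. Set $u'=u-vB$. Let $v_1$, $A_1$ be the odd parts of $v$, $A$ ($v_1=1$ if $v=0$). Define the integer $\theta=(N-1)v\left(u'\frac{C}{Np}+A\left(\frac up(1-u'^2)-u'\right)\right)+3v_1A_1(N_1-1)(u'-1)+\frac{3\lambda(N)(u'^2-1)}{2}.$ The notation $2^k\,\|\,n$ means $2^k\mid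 n$ and $2^{k+1}\nmid n$. -}

module Defs where

open import Data.Nat as ℕ using (ℕ)
open import Data.Nat.Primality using (Prime)
open import Data.Integer using (ℤ; +_; _+_; _-_; _*_; -_; _<_; _≤_; ∣_∣; 0ℤ; 1ℤ)
open import Data.Integer.Divisibility using (_∣_)
open import Data.Integer.GCD using (gcd)
open import Data.Product using (Σ; ∃; _×_; _,_)
open import Data.Sum using (_⊎_)
open import Relation.Binary.PropositionalEquality using (_≡_)
open import Relation.Nullary using (¬_)

two^ : ℕ → ℤ
two^ k = + (2 ℕ.^ k)

Odd : ℤ → Set
Odd n = ¬ (+ 2 ∣ n)

infix 4 _∥_
_∥_ : ℕ → ℤ → Set
k ∥ n = (two^ k ∣ n) × ¬ (two^ (ℕ.suc k) ∣ n)

infix 4 _≡_[mod_]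
_≡_[mod_] : ℤ → ℤ → ℤ → Set
a ≡ b [mod m ] = m ∣ (a - b)

SquareFree : ℤ → Set
SquareFree m = ∀ (d : ℕ) → (+ (d ℕ.* d)) ∣ m → d ≡ 1

FundamentalDiscriminant : ℤ → Set
FundamentalDiscriminant Δ =
  (Δ ≡ 1ℤ [mod + 4 ] × SquareFree Δ × ¬ (Δ ≡ 1ℤ))
  ⊎ Σ ℤ (λ m → (Δ ≡ + 4 * m) × SquareFree m
                 × ((m ≡ + 2 [mod + 4 ]) ⊎ (m ≡ + 3 [mod + 4 ])))

-- odd part of an integer v (with the convention that the odd part of 0 is 1):
-- v₁ is the odd part of v iff v = 2^k v₁ with v₁ odd (for v ≠ 0), and v₁ = 1 if v = 0
IsOddPart : ℤ → ℤ → Set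
IsOddPart v v₁ = (v ≡ 0ℤ × v₁ ≡ 1ℤ) ⊎ (¬ (v ≡ 0ℤ) × Odd v₁ × ∃ λ k → v ≡ two^ k * v₁)

IsTwoAdicDecomp : ℕ → ℕ → ℕ → Set
IsTwoAdicDecomp N λN N₁ = (N ≡ 2 ℕ.^ λN ℕ.* N₁) × Odd (+ N₁)

-- a prime p (not dividing the conductor, odd) splits in the order of discriminant D
-- iff p ∤ D and D is a nonzero square modulo p
SplitsIn : ℕ → ℤ → Set
SplitsIn p D = ¬ (+ p ∣ D) × ∃ λ x → (x * x) ≡ D [mod + p ]

-- θ, written with the integers  Cq = C/(Np),  uq = u/p,  t = 3λ(N)(u'^2-1)/2
θ : (N λN : ℕ) (A B C u v v₁ A₁ N₁ Cq uq t : ℤ) → ℤ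
θ N λN A B C u v v₁ A₁ N₁ Cq uq t =
  let u' = u - v * B in
  (+ N - 1ℤ) * v * (u' * Cq + A * (uq * (1ℤ - u' * u') - u'))
  + + 3 * v₁ * A₁ * (N₁ - 1ℤ) * (u' - 1ℤ)
  + t

{-# OPTIONS --safe #-}
-- Write u = p·uq, C = N·p·Cq and u′ = u − vB. Dividing the norm equation by p gives the reduced
-- norm equation p·uq² − uq·v·B + v²·A·N·Cq = 1, and comparing D = B² − 4AC with
-- B² ≡ D + 4rN (mod 32N) gives A·p·Cq ≡ r (mod 8); as N is even, uq, u′, A, p and Cq are odd.
-- Since N is a square, λ(N) is even and N₁ ≡ 1 (mod 8), which kills the last two summands of θ
-- modulo 8, so it remains to show 8 ∣ v·X for the bracket X of θ. Squares of odd numbers are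
-- 1 mod 8, so v·X ≡ u′·v·(Cq − A) ≡ u′·A·p·v·(r − p), and v times the reduced norm equation turns
-- v·(r − p) into R = v(r − 1) − uq·v²·B + v³·A·N·Cq (mod 8).
-- An even square N has 2 ∥ N or 16 ∣ N, and B² ≡ D + 4rN (mod 32) then reads B² ≡ 16 or 0
-- (mod 32), i.e. 2 ∥ B or 8 ∣ B: this is the second half of the theorem. In every case R is
-- 4·x·(a + b·x) + 8·y with a and b odd whenever x is, hence R ≡ 0 (mod 8); in case (a) B is odd,
-- which forces v to be even.
module Submission where

open import Defs
open import Data.Nat as ℕ using (ℕ)
open import Data.Nat.Primality using (Prime)
open import Data.Integer using (ℤ; +_; _+_; _-_; _*_; -_; _<_; _≤_; 0ℤ; 1ℤ)
open import Data.Integer.Divisibility using (_∣_)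
open import Data.Integer.GCD using (gcd)
open import Data.Product using (Σ; ∃; _×_; _,_)
open import Data.Sum using (_⊎_)
open import Relation.Binary.PropositionalEquality using (_≡_)
open import Relation.Nullary using (¬_)

open import Data.Empty using (⊥-elim)
open import Data.Integer using (NonZero)
open import Data.Integer.DivMod using (_%ℕ_; _/ℕ_; a≡a%ℕn+[a/ℕn]*n; n%ℕd<d)
-- Signed divisibility carries a quotient and is used for all computations. Defs' _∣_, _∥_ and
-- _≡_[mod_] are unsigned (stated on ∣_∣), so their integer arguments can never be inferred.
open import Data.Integer.Divisibility.Signed as Signed
  using (divides; ∣m∣n⇒∣m+n; ∣m∣n⇒∣m-n; ∣n⇒∣m*n; ∣m⇒∣m*n; ∣-refl; ∣-trans; ∣ᵤ⇒∣; ∣⇒∣ᵤ)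
  renaming (_∣_ to _∣ₛ_)
import Data.Integer.Properties as ℤ
open import Data.Integer.Tactic.RingSolver using (solve; solve-∀)
open import Data.List using (_∷_; [])
import Data.Nat.Divisibility as ℕD
open import Data.Nat.Primality using (prime⇒nonZero)
import Data.Nat.Properties as ℕP
open import Data.Product using (∃-syntax; proj₁; proj₂)
open import Data.Sum using (inj₁; inj₂)
open import Relation.Binary.PropositionalEquality
  using (refl; sym; trans; cong; cong₂; subst; subst₂; module ≡-Reasoning)

-- Oddness with an explicit witness, the form the ring solver can use (Defs' Odd is ¬ 2 ∣ x).
IsOdd : ℤ → Set
IsOdd x = ∃[ k ] x ≡ + 2 * k + 1ℤ

data Parity (x : ℤ) : Set where
  even : ∀ k → x ≡ + 2 * k → Parity x
  odd  : ∀ k → x ≡ + 2 * k + 1ℤ → Parity x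

parity : ∀ x → Parity x
parity x with x %ℕ 2 | x /ℕ 2 | a≡a%ℕn+[a/ℕn]*n x 2 | n%ℕd<d x 2
... | 0 | q | x≡ | _ = even q (trans x≡ (trans (ℤ.+-identityˡ (q * + 2)) (ℤ.*-comm q (+ 2))))
... | 1 | q | x≡ | _ = odd q (trans x≡ (trans (ℤ.+-comm 1ℤ (q * + 2)) (cong (_+ 1ℤ) (ℤ.*-comm q (+ 2)))))
... | ℕ.suc (ℕ.suc _) | _ | _ | ℕ.s≤s (ℕ.s≤s ())

≡*⇒∣ : ∀ m {x} k → x ≡ m * k → m ∣ₛ x
≡*⇒∣ m k x≡m*k = divides k (trans x≡m*k (ℤ.*-comm m k))

2∤1 : ¬ (+ 2 ∣ₛ 1ℤ)
2∤1 2∣1 with ℕD.∣1⇒≡1 (∣⇒∣ᵤ 2∣1)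
... | ()

even⇒¬odd : ∀ {x} → + 2 ∣ₛ x → ¬ IsOdd x
even⇒¬odd 2∣x (k , refl) = 2∤1 (subst (+ 2 ∣ₛ_) 2k+1-2k≡1 (∣m∣n⇒∣m-n 2∣x (∣n⇒∣m*n k (∣-refl {+ 2}))))
  where
  2k+1-2k≡1 : + 2 * k + 1ℤ - k * + 2 ≡ 1ℤ
  2k+1-2k≡1 = solve (k ∷ [])

Odd⇒IsOdd : ∀ {x} → Odd x → IsOdd x
Odd⇒IsOdd {x} x-odd with parity x
... | even k x≡2k = ⊥-elim (x-odd (∣⇒∣ᵤ (≡*⇒∣ (+ 2) k x≡2k)))
... | odd k x≡2k+1 = k , x≡2k+1

odd-* : ∀ {a b} → IsOdd a → IsOdd b → IsOdd (a * b)
odd-* (k , refl) (l , refl) = + 2 * k * l + k + l , product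
  where
  product : (+ 2 * k + 1ℤ) * (+ 2 * l + 1ℤ) ≡ + 2 * (+ 2 * k * l + k + l) + 1ℤ
  product = solve (k ∷ l ∷ [])

odd-neg : ∀ {a} → IsOdd a → IsOdd (- a)
odd-neg (k , refl) = - k - 1ℤ , negation
  where
  negation : - (+ 2 * k + 1ℤ) ≡ + 2 * (- k - 1ℤ) + 1ℤ
  negation = solve (k ∷ [])

odd-*ˡ : ∀ {a b} → IsOdd (a * b) → IsOdd a
odd-*ˡ {a} {b} ab-odd with parity a
... | even k a≡2k = ⊥-elim (even⇒¬odd (∣m⇒∣m*n b (≡*⇒∣ (+ 2) k a≡2k)) ab-odd)
... | odd k a≡2k+1 = k , a≡2k+1

odd-*ʳ : ∀ {a b} → IsOdd (a * b) → IsOdd b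
odd-*ʳ {a} {b} ab-odd = odd-*ˡ (subst IsOdd (ℤ.*-comm a b) ab-odd)

odd-≡-mod2 : ∀ {x y} → + 2 ∣ₛ x - y → IsOdd y → IsOdd x
odd-≡-mod2 {x} (divides q x-y≡2q) (k , refl) = q + k , (begin
  x                                     ≡⟨ solve (x ∷ k ∷ []) ⟩
  (x - (+ 2 * k + 1ℤ)) + (+ 2 * k + 1ℤ) ≡⟨ cong (_+ (+ 2 * k + 1ℤ)) x-y≡2q ⟩
  q * + 2 + (+ 2 * k + 1ℤ)              ≡⟨ solve (q ∷ k ∷ []) ⟩
  + 2 * (q + k) + 1ℤ                    ∎)
  where open ≡-Reasoning

odd-square-mod8 : ∀ {x} → IsOdd x → + 8 ∣ₛ x * x - 1ℤ
odd-square-mod8 (k , refl) with parity k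
... | even j refl = divides (j * (+ 2 * j + 1ℤ)) square
  where
  square : (+ 2 * (+ 2 * j) + 1ℤ) * (+ 2 * (+ 2 * j) + 1ℤ) - 1ℤ ≡ j * (+ 2 * j + 1ℤ) * + 8
  square = solve (j ∷ [])
... | odd j refl = divides ((+ 2 * j + 1ℤ) * (j + 1ℤ)) square
  where
  square : (+ 2 * (+ 2 * j + 1ℤ) + 1ℤ) * (+ 2 * (+ 2 * j + 1ℤ) + 1ℤ) - 1ℤ ≡ (+ 2 * j + 1ℤ) * (j + 1ℤ) * + 8
  square = solve (j ∷ [])

even-x[a+bx] : ∀ {x a b} → (IsOdd x → IsOdd a × IsOdd b) → + 2 ∣ₛ x * (a + b * x)
even-x[a+bx] {x} {a} {b} x-odd⇒a,b-odd with parity x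
... | even k refl = ∣m⇒∣m*n (a + b * (+ 2 * k)) (≡*⇒∣ (+ 2) k refl)
... | odd k refl with x-odd⇒a,b-odd (k , refl)
...   | (i , refl) , (j , refl) = ≡*⇒∣ (+ 2) ((+ 2 * k + 1ℤ) * (i + j * (+ 2 * k + 1ℤ) + k + 1ℤ)) expand
  where
  expand : (+ 2 * k + 1ℤ) * ((+ 2 * i + 1ℤ) + (+ 2 * j + 1ℤ) * (+ 2 * k + 1ℤ))
         ≡ + 2 * ((+ 2 * k + 1ℤ) * (i + j * (+ 2 * k + 1ℤ) + k + 1ℤ))
  expand = solve (k ∷ i ∷ j ∷ [])

8∣4x[a+bx]+8y : ∀ {x a b} → (IsOdd x → IsOdd a × IsOdd b) → ∀ y → + 8 ∣ₛ + 4 * (x * (a + b * x)) + + 8 * y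
8∣4x[a+bx]+8y x-odd⇒a,b-odd y =
  ∣m∣n⇒∣m+n (Signed.*-monoʳ-∣ (+ 4) (even-x[a+bx] x-odd⇒a,b-odd)) (∣m⇒∣m*n y (∣-refl {+ 8}))

≡-mod⇒≡ : ∀ {m a b} → m ∣ₛ a - b → ∃[ q ] a ≡ q * m + b
≡-mod⇒≡ {m} {a} {b} (divides q a-b≡qm) = q , (begin
  a             ≡⟨ solve (a ∷ b ∷ []) ⟩
  (a - b) + b   ≡⟨ cong (_+ b) a-b≡qm ⟩
  q * m + b     ∎)
  where open ≡-Reasoning

≡-mod-trans : ∀ {m a b c} → m ∣ₛ a - b → m ∣ₛ b - c → m ∣ₛ a - c
≡-mod-trans {m} {a} {b} {c} m∣a-b m∣b-c = subst (m ∣ₛ_) (telescope a b c) (∣m∣n⇒∣m+n m∣a-b m∣b-c)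
  where
  telescope : ∀ a b c → (a - b) + (b - c) ≡ a - c
  telescope = solve-∀

∣m-n∣n⇒∣m : ∀ {i m n} → i ∣ₛ m - n → i ∣ₛ n → i ∣ₛ m
∣m-n∣n⇒∣m {i} {m} {n} i∣m-n i∣n = subst (i ∣ₛ_) (m-n+n≡m m n) (∣m∣n⇒∣m+n i∣m-n i∣n)
  where
  m-n+n≡m : ∀ m n → m - n + n ≡ m
  m-n+n≡m = solve-∀

≡-mod-m*n⇒∣ : ∀ {a b} m n → a ≡ b [mod + (m ℕ.* n) ] → + m * + n ∣ₛ a - b
≡-mod-m*n⇒∣ {a} {b} m n mn∣a-b = subst (_∣ₛ a - b) (ℤ.pos-* m n) (∣ᵤ⇒∣ {+ (m ℕ.* n)} {a - b} mn∣a-b)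

≡-mod-m*n⇒≡-mod-m : ∀ {a b} m n → a ≡ b [mod + (m ℕ.* n) ] → + m ∣ₛ a - b
≡-mod-m*n⇒≡-mod-m {a} m n a≡b = ∣-trans (∣m⇒∣m*n (+ n) ∣-refl) (≡-mod-m*n⇒∣ {a} m n a≡b)

-- Two-adic valuations and squares

two^-suc : ∀ k → two^ (ℕ.suc k) ≡ + 2 * two^ k
two^-suc k = ℤ.pos-* 2 (2 ℕ.^ k)

∥⇒odd-cofactor : ∀ {k x} → k ∥ x → ∃[ n ] x ≡ two^ k * n × IsOdd n
∥⇒odd-cofactor {k} {x} (2^k∣x , 2^k+1∤x) with ∣ᵤ⇒∣ 2^k∣x
... | divides n x≡n*2^k with parity n
...   | odd j n≡2j+1 = n , trans x≡n*2^k (ℤ.*-comm n (two^ k)) , j , n≡2j+1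
...   | even j refl = ⊥-elim (2^k+1∤x (∣⇒∣ᵤ (divides j (begin
  x                 ≡⟨ x≡n*2^k ⟩
  + 2 * j * two^ k  ≡⟨ regroup (+ 2) j (two^ k) ⟩
  j * (+ 2 * two^ k) ≡⟨ cong (j *_) (two^-suc k) ⟨
  j * two^ (ℕ.suc k) ∎))))
  where
  open ≡-Reasoning
  regroup : ∀ a b c → a * b * c ≡ b * (a * c)
  regroup = solve-∀

odd-cofactor⇒∥ : ∀ {k x n} → x ≡ two^ k * n → IsOdd n → k ∥ x
odd-cofactor⇒∥ {k} {x} {n} x≡2^k*n n-odd = ∣⇒∣ᵤ (≡*⇒∣ (two^ k) n x≡2^k*n) , 2^k+1∤x
  where
  2^k+1∤x : ¬ (two^ (ℕ.suc k) ∣ x)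
  2^k+1∤x 2^k+1∣x with ∣ᵤ⇒∣ 2^k+1∣x
  ... | divides q x≡q*2^k+1 = even⇒¬odd (≡*⇒∣ (+ 2) q n≡2q) n-odd
    where
    open ≡-Reasoning
    regroup : ∀ a b c → a * (b * c) ≡ c * (b * a)
    regroup = solve-∀
    n≡2q : n ≡ + 2 * q
    n≡2q = ℤ.*-cancelˡ-≡ (two^ k) n (+ 2 * q) {{ℕP.m^n≢0 2 k}} (begin
      two^ k * n         ≡⟨ x≡2^k*n ⟨
      x                  ≡⟨ x≡q*2^k+1 ⟩
      q * two^ (ℕ.suc k) ≡⟨ cong (q *_) (two^-suc k) ⟩
      q * (+ 2 * two^ k) ≡⟨ regroup q (+ 2) (two^ k) ⟩
      two^ k * (+ 2 * q) ∎)

halve-square : ∀ {m y} → m * m ≡ + 2 * y → ∃[ k ] m ≡ + 2 * k × y ≡ + 2 * (k * k)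
halve-square {m} {y} m²≡2y with parity m
... | odd k m≡2k+1 = ⊥-elim (even⇒¬odd (≡*⇒∣ (+ 2) y m²≡2y) (odd-* (k , m≡2k+1) (k , m≡2k+1)))
... | even k refl = k , refl , ℤ.*-cancelˡ-≡ (+ 2) y (+ 2 * (k * k)) (trans (sym m²≡2y) (square k))
  where
  square : ∀ k → (+ 2 * k) * (+ 2 * k) ≡ + 2 * (+ 2 * (k * k))
  square = solve-∀

quarter-square : ∀ {m y} → m * m ≡ + 4 * y → ∃[ k ] m ≡ + 2 * k × k * k ≡ y
quarter-square {m} {y} m²≡4y with halve-square {m} {+ 2 * y} (trans m²≡4y (ℤ.*-assoc (+ 2) (+ 2) y))
... | k , m≡2k , 2y≡2k² = k , m≡2k , sym (ℤ.*-cancelˡ-≡ (+ 2) y (k * k) 2y≡2k²)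

square-two^*odd : ∀ e {n m} → IsOdd n → two^ e * n ≡ m * m → (∃[ j ] e ≡ 2 ℕ.* j) × + 8 ∣ₛ n - 1ℤ
square-two^*odd 0 {n} {m} n-odd n≡m² =
  (0 , refl) , subst (λ x → + 8 ∣ₛ x - 1ℤ) m²≡n (odd-square-mod8 {m} (odd-*ˡ {b = m} (subst IsOdd (sym m²≡n) n-odd)))
  where
  m²≡n : m * m ≡ n
  m²≡n = trans (sym n≡m²) (ℤ.*-identityˡ n)
square-two^*odd 1 {n} {m} n-odd 2n≡m² with halve-square {m} {n} (sym 2n≡m²)
... | k , _ , n≡2k² = ⊥-elim (even⇒¬odd (≡*⇒∣ (+ 2) (k * k) n≡2k²) n-odd)
square-two^*odd (ℕ.suc (ℕ.suc e)) {n} {m} n-odd 4·2^e·n≡m² with halve-square {m} {+ 2 * (two^ e * n)} (sym 2·2·2^e·n≡m²)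
  where
  2·2·2^e·n≡m² : + 2 * (+ 2 * (two^ e * n)) ≡ m * m
  2·2·2^e·n≡m² = begin
    + 2 * (+ 2 * (two^ e * n))     ≡⟨ regroup (+ 2) (+ 2) (two^ e) n ⟩
    + 2 * (+ 2 * two^ e) * n       ≡⟨ cong (λ x → + 2 * x * n) (two^-suc e) ⟨
    + 2 * two^ (ℕ.suc e) * n       ≡⟨ cong (_* n) (two^-suc (ℕ.suc e)) ⟨
    two^ (ℕ.suc (ℕ.suc e)) * n     ≡⟨ 4·2^e·n≡m² ⟩
    m * m                          ∎
    where
    open ≡-Reasoning
    regroup : ∀ a b c d → a * (b * (c * d)) ≡ a * (b * c) * d
    regroup = solve-∀
... | k , _ , 2·2^e·n≡2k² with square-two^*odd e {n} {k} n-odd (ℤ.*-cancelˡ-≡ (+ 2) (two^ e * n) (k * k) 2·2^e·n≡2k²)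
...   | (j , e≡2j) , 8∣n-1 = (ℕ.suc j , trans (cong (ℕ._+_ 2) e≡2j) (sym (ℕP.*-suc 2 j))) , 8∣n-1

square-twoAdicDecomp : ∀ {N λN N₁ m} → IsTwoAdicDecomp N λN N₁ → N ≡ m ℕ.* m →
                       (∃[ j ] λN ≡ 2 ℕ.* j) × + 8 ∣ₛ + N₁ - 1ℤ
square-twoAdicDecomp {N} {λN} {N₁} {m} (N≡2^λN*N₁ , N₁-odd) N≡m² =
  square-two^*odd λN {+ N₁} {+ m} (Odd⇒IsOdd N₁-odd) (begin
    two^ λN * + N₁       ≡⟨ ℤ.pos-* (2 ℕ.^ λN) N₁ ⟨
    + (2 ℕ.^ λN ℕ.* N₁)  ≡⟨ cong +_ (trans (sym N≡2^λN*N₁) N≡m²) ⟩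
    + (m ℕ.* m)          ≡⟨ ℤ.pos-* m m ⟩
    + m * + m            ∎)
  where open ≡-Reasoning

evenSquare-2∥⊎16∣ : ∀ {N λN N₁ m} → IsTwoAdicDecomp N λN N₁ → N ≡ m ℕ.* m →
                    + 2 ∣ + N → 2 ∥ + N ⊎ + 16 ∣ + N
evenSquare-2∥⊎16∣ {N} {λN} {N₁} {m} decomp N≡m² 2∣N
  with square-twoAdicDecomp {N} {λN} {N₁} {m} decomp N≡m² | decomp
... | (0 , refl) , _ | N≡N₁ , N₁-odd =
  ⊥-elim (N₁-odd (subst (λ x → + 2 ∣ + x) (trans N≡N₁ (ℕP.*-identityˡ N₁)) 2∣N))
... | (1 , refl) , _ | N≡4N₁ , N₁-odd =
  inj₁ (odd-cofactor⇒∥ {2} (trans (cong +_ N≡4N₁) (ℤ.pos-* 4 N₁)) (Odd⇒IsOdd N₁-odd))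
... | (ℕ.suc (ℕ.suc i) , refl) , _ | N≡ , _ = inj₂ (ℕD.divides (2 ℕ.^ (2 ℕ.* i) ℕ.* N₁) (begin
  N                                ≡⟨ N≡ ⟩
  2 ℕ.^ (2 ℕ.* (2 ℕ.+ i)) ℕ.* N₁   ≡⟨ cong (λ e → 2 ℕ.^ e ℕ.* N₁) (ℕP.*-distribˡ-+ 2 2 i) ⟩
  2 ℕ.^ (4 ℕ.+ 2 ℕ.* i) ℕ.* N₁     ≡⟨ cong (ℕ._* N₁) (ℕP.^-distribˡ-+-* 2 4 (2 ℕ.* i)) ⟩
  16 ℕ.* 2 ℕ.^ (2 ℕ.* i) ℕ.* N₁    ≡⟨ ℕP.*-assoc 16 (2 ℕ.^ (2 ℕ.* i)) N₁ ⟩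
  16 ℕ.* (2 ℕ.^ (2 ℕ.* i) ℕ.* N₁)  ≡⟨ ℕP.*-comm 16 (2 ℕ.^ (2 ℕ.* i) ℕ.* N₁) ⟩
  2 ℕ.^ (2 ℕ.* i) ℕ.* N₁ ℕ.* 16    ∎))
  where open ≡-Reasoning

square≡16-mod32⇒2∥ : ∀ {B} → + 32 ∣ₛ B * B - + 16 → 2 ∥ B
square≡16-mod32⇒2∥ {B} 32∣B²-16 with ≡-mod⇒≡ 32∣B²-16
... | q , B²≡32q+16 with quarter-square {B} {+ 8 * q + + 4} (trans B²≡32q+16 (32q+16≡4[8q+4] q))
  where
  32q+16≡4[8q+4] : ∀ q → q * + 32 + + 16 ≡ + 4 * (+ 8 * q + + 4)
  32q+16≡4[8q+4] = solve-∀
...   | k , B≡2k , k²≡8q+4 with quarter-square {k} {+ 2 * q + 1ℤ} (trans k²≡8q+4 (8q+4≡4[2q+1] q))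
  where
  8q+4≡4[2q+1] : ∀ q → + 8 * q + + 4 ≡ + 4 * (+ 2 * q + 1ℤ)
  8q+4≡4[2q+1] = solve-∀
...     | b , k≡2b , b²≡2q+1 = odd-cofactor⇒∥ {2} {B} {b} B≡4b (odd-*ˡ {b} {b} (q , b²≡2q+1))
  where
  B≡4b : B ≡ + 4 * b
  B≡4b = trans B≡2k (trans (cong (+ 2 *_) k≡2b) (sym (ℤ.*-assoc (+ 2) (+ 2) b)))

square≡0-mod32⇒8∣ : ∀ {B} → + 32 ∣ₛ B * B → + 8 ∣ B
square≡0-mod32⇒8∣ {B} (divides q B²≡32q) with quarter-square {B} {+ 8 * q} (trans B²≡32q (32q≡4[8q] q))
  where
  32q≡4[8q] : ∀ q → q * + 32 ≡ + 4 * (+ 8 * q)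
  32q≡4[8q] = solve-∀
... | k , refl , k²≡8q with quarter-square {k} {+ 2 * q} (trans k²≡8q (ℤ.*-assoc (+ 4) (+ 2) q))
...   | l , refl , l²≡2q with halve-square {l} {q} l²≡2q
...     | e , refl , _ = ∣⇒∣ᵤ (≡*⇒∣ (+ 8) e (2[2[2e]]≡8e e))
  where
  2[2[2e]]≡8e : ∀ e → + 2 * (+ 2 * (+ 2 * e)) ≡ + 8 * e
  2[2[2e]]≡8e = solve-∀

-- The 2-adic valuation of B

B²≡16-mod32⇒2∥B : ∀ {B X} n → B * B ≡ X [mod + (32 ℕ.* n) ] → + 32 ∣ₛ X - + 16 → 2 ∥ B
B²≡16-mod32⇒2∥B {B} n B²≡X 32∣X-16 =
  square≡16-mod32⇒2∥ {B} (≡-mod-trans {a = B * B} (≡-mod-m*n⇒≡-mod-m {B * B} 32 n B²≡X) 32∣X-16)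

B²≡0-mod32⇒8∣B : ∀ {B X} n → B * B ≡ X [mod + (32 ℕ.* n) ] → + 32 ∣ₛ X → + 8 ∣ B
B²≡0-mod32⇒8∣B {B} n B²≡X 32∣X =
  square≡0-mod32⇒8∣ {B} (∣m-n∣n⇒∣m {m = B * B} (≡-mod-m*n⇒≡-mod-m {B * B} 32 n B²≡X) 32∣X)

B-shape-r≡1 : ∀ {N B D r} → B * B ≡ D + + 4 * + r * + N [mod + (32 ℕ.* N) ] → r ≡ 1 × + 32 ∣ D →
              (2 ∥ + N → 2 ∥ B) × (+ 16 ∣ + N → + 8 ∣ B)
B-shape-r≡1 {N} {B} {D} B²≡D+4N (refl , 32∣D) with ∣ᵤ⇒∣ {+ 32} {D} 32∣D
... | divides d D≡32d = 2∥N⇒2∥B , 16∣N⇒8∣B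
  where
  open ≡-Reasoning
  2∥N⇒2∥B : 2 ∥ + N → 2 ∥ B
  2∥N⇒2∥B 2∥N with ∥⇒odd-cofactor {2} {+ N} 2∥N
  ... | n , N≡4n , k , n≡2k+1 = B²≡16-mod32⇒2∥B {B} {D + + 4 * + 1 * + N} N B²≡D+4N (divides (d + k) (begin
    D + + 4 * + 1 * + N - + 16
      ≡⟨ cong₂ (λ x y → x + + 4 * + 1 * y - + 16) D≡32d (trans N≡4n (cong (+ 4 *_) n≡2k+1)) ⟩
    d * + 32 + + 4 * + 1 * (+ 4 * (+ 2 * k + 1ℤ)) - + 16
      ≡⟨ regroup d k ⟩
    (d + k) * + 32 ∎))
    where
    regroup : ∀ d k → d * + 32 + + 4 * + 1 * (+ 4 * (+ 2 * k + 1ℤ)) - + 16 ≡ (d + k) * + 32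
    regroup = solve-∀
  16∣N⇒8∣B : + 16 ∣ + N → + 8 ∣ B
  16∣N⇒8∣B 16∣N with ∣ᵤ⇒∣ {+ 16} {+ N} 16∣N
  ... | divides n N≡16n = B²≡0-mod32⇒8∣B {B} {D + + 4 * + 1 * + N} N B²≡D+4N (divides (d + + 2 * n) (begin
    D + + 4 * + 1 * + N               ≡⟨ cong₂ (λ x y → x + + 4 * + 1 * y) D≡32d N≡16n ⟩
    d * + 32 + + 4 * + 1 * (n * + 16) ≡⟨ regroup d n ⟩
    (d + + 2 * n) * + 32              ∎))
    where
    regroup : ∀ d n → d * + 32 + + 4 * + 1 * (n * + 16) ≡ (d + + 2 * n) * + 32
    regroup = solve-∀

B-shape-r≡5 : ∀ {N B D r} → B * B ≡ D + + 4 * + r * + N [mod + (32 ℕ.* N) ] → r ≡ 5 × 4 ∥ D →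
              (+ 16 ∣ + N → 2 ∥ B) × (2 ∥ + N → + 8 ∣ B)
B-shape-r≡5 {N} {B} {D} B²≡D+20N (refl , 4∥D) with ∥⇒odd-cofactor {4} {D} 4∥D
... | d , D≡16d , δ , d≡2δ+1 = 16∣N⇒2∥B , 2∥N⇒8∣B
  where
  open ≡-Reasoning
  D≡16[2δ+1] : D ≡ + 16 * (+ 2 * δ + 1ℤ)
  D≡16[2δ+1] = trans D≡16d (cong (+ 16 *_) d≡2δ+1)
  16∣N⇒2∥B : + 16 ∣ + N → 2 ∥ B
  16∣N⇒2∥B 16∣N with ∣ᵤ⇒∣ {+ 16} {+ N} 16∣N
  ... | divides n N≡16n = B²≡16-mod32⇒2∥B {B} {D + + 4 * + 5 * + N} N B²≡D+20N (divides (δ + + 10 * n) (begin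
    D + + 4 * + 5 * + N - + 16
      ≡⟨ cong₂ (λ x y → x + + 4 * + 5 * y - + 16) D≡16[2δ+1] N≡16n ⟩
    + 16 * (+ 2 * δ + 1ℤ) + + 4 * + 5 * (n * + 16) - + 16
      ≡⟨ regroup δ n ⟩
    (δ + + 10 * n) * + 32 ∎))
    where
    regroup : ∀ δ n → + 16 * (+ 2 * δ + 1ℤ) + + 4 * + 5 * (n * + 16) - + 16 ≡ (δ + + 10 * n) * + 32
    regroup = solve-∀
  2∥N⇒8∣B : 2 ∥ + N → + 8 ∣ B
  2∥N⇒8∣B 2∥N with ∥⇒odd-cofactor {2} {+ N} 2∥N
  ... | n , N≡4n , k , n≡2k+1 = B²≡0-mod32⇒8∣B {B} {D + + 4 * + 5 * + N} N B²≡D+20N (divides (δ + + 5 * k + + 3) (begin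
    D + + 4 * + 5 * + N
      ≡⟨ cong₂ (λ x y → x + + 4 * + 5 * y) D≡16[2δ+1] (trans N≡4n (cong (+ 4 *_) n≡2k+1)) ⟩
    + 16 * (+ 2 * δ + 1ℤ) + + 4 * + 5 * (+ 4 * (+ 2 * k + 1ℤ))
      ≡⟨ regroup δ k ⟩
    (δ + + 5 * k + + 3) * + 32 ∎))
    where
    regroup : ∀ δ k → + 16 * (+ 2 * δ + 1ℤ) + + 4 * + 5 * (+ 4 * (+ 2 * k + 1ℤ)) ≡ (δ + + 5 * k + + 3) * + 32
    regroup = solve-∀

-- The reduced norm equation

-- The norm u² − uvB + v²AC of π, divided by p, when u = p·uq and C = N·p·Cq.
reducedNorm : (p uq v A B N Cq : ℤ) → ℤ
reducedNorm p uq v A B N Cq = p * uq * uq - uq * v * B + v * v * A * N * Cq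

norm≡p⇒reducedNorm≡1 : ∀ {uq v A B N Cq} p .{{_ : NonZero p}} →
  p ≡ (p * uq) * (p * uq) - (p * uq) * v * B + v * v * A * (N * p * Cq) →
  reducedNorm p uq v A B N Cq ≡ 1ℤ
norm≡p⇒reducedNorm≡1 {uq} {v} {A} {B} {N} {Cq} p p≡norm =
  sym (ℤ.*-cancelˡ-≡ p 1ℤ (reducedNorm p uq v A B N Cq) (begin
    p * 1ℤ                                                                 ≡⟨ ℤ.*-identityʳ p ⟩
    p                                                                      ≡⟨ p≡norm ⟩
    (p * uq) * (p * uq) - (p * uq) * v * B + v * v * A * (N * p * Cq)      ≡⟨ factor p uq v A B N Cq ⟩
    p * (p * uq * uq - uq * v * B + v * v * A * N * Cq)                    ∎))
  where
  open ≡-Reasoning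
  factor : ∀ p uq v A B N Cq → (p * uq) * (p * uq) - (p * uq) * v * B + v * v * A * (N * p * Cq)
                             ≡ p * (p * uq * uq - uq * v * B + v * v * A * N * Cq)
  factor = solve-∀

reducedNorm≡1⇒odd : ∀ {p uq v A B N Cq} → reducedNorm p uq v A B N Cq ≡ 1ℤ → + 2 ∣ₛ N →
                    IsOdd (uq * (p * uq - v * B))
reducedNorm≡1⇒odd {p} {uq} {v} {A} {B} {N} {Cq} Q≡1 (divides n refl) =
  odd-≡-mod2 (divides (- (v * v * A * n * Cq)) (begin
    uq * (p * uq - v * B) - 1ℤ                                  ≡⟨ cong (_-_ (uq * (p * uq - v * B))) Q≡1 ⟨
    uq * (p * uq - v * B) - reducedNorm p uq v A B (n * + 2) Cq ≡⟨ regroup p uq v A B n Cq ⟩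
    - (v * v * A * n * Cq) * + 2                                ∎)) (0ℤ , refl)
  where
  open ≡-Reasoning
  regroup : ∀ p uq v A B n Cq → uq * (p * uq - v * B) - (p * uq * uq - uq * v * B + v * v * A * (n * + 2) * Cq)
                              ≡ - (v * v * A * n * Cq) * + 2
  regroup = solve-∀

reducedNorm≡1⇒2∣v : ∀ {p uq v A B N Cq} → reducedNorm p uq v A B N Cq ≡ 1ℤ → + 2 ∣ₛ N →
                    IsOdd p → IsOdd B → + 2 ∣ₛ v
reducedNorm≡1⇒2∣v {p} {uq} {v} {A} {B} {N} {Cq} Q≡1 2∣N p-odd B-odd with parity v
... | even k v≡2k = ≡*⇒∣ (+ 2) k v≡2k
... | odd k v≡2k+1 = ⊥-elim (even⇒¬odd 2∣uq·u′ (reducedNorm≡1⇒odd {p} {uq} {v} {A} {B} {N} {Cq} Q≡1 2∣N))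
  where
  regroup : ∀ uq p v B → uq * (- (v * B) + p * uq) ≡ uq * (p * uq - v * B)
  regroup = solve-∀
  2∣uq·u′ : + 2 ∣ₛ uq * (p * uq - v * B)
  2∣uq·u′ = subst (+ 2 ∣ₛ_) (regroup uq p v B)
    (even-x[a+bx] {uq} { - (v * B)} {p} (λ _ → odd-neg (odd-* (k , v≡2k+1) B-odd) , p-odd))

ApCq≡r-mod8 : ∀ {A B p r Cq} N .{{_ : NonZero N}} →
              + 32 * N ∣ₛ B * B - ((B * B - + 4 * A * (N * p * Cq)) + + 4 * r * N) →
              + 8 ∣ₛ A * p * Cq - r
ApCq≡r-mod8 {A} {B} {p} {r} {Cq} N 32N∣ =
  Signed.*-cancelˡ-∣ N (Signed.*-cancelˡ-∣ (+ 4) (subst₂ _∣ₛ_ (regroup-modulus N) (regroup B A N p Cq r) 32N∣))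
  where
  regroup-modulus : ∀ N → + 32 * N ≡ + 4 * (N * + 8)
  regroup-modulus = solve-∀
  regroup : ∀ B A N p Cq r → B * B - ((B * B - + 4 * A * (N * p * Cq)) + + 4 * r * N)
                           ≡ + 4 * (N * (A * p * Cq - r))
  regroup = solve-∀

-- Reducing v·X to R, and R modulo 8

-- v·(r − p) minus v·(reduced norm − 1) and v·p·(uq² − 1), both 0 mod 8.
R : (r v uq B A N Cq : ℤ) → ℤ
R r v uq B A N Cq = v * (r - 1ℤ) - uq * v * v * B + v * v * v * A * N * Cq

8∣R⇒8∣v[r-p] : ∀ {p uq v A B N Cq r} → reducedNorm p uq v A B N Cq ≡ 1ℤ → IsOdd uq →
               + 8 ∣ₛ R r v uq B A N Cq → + 8 ∣ₛ v * (r - p)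
8∣R⇒8∣v[r-p] {p} {uq} {v} {A} {B} {N} {Cq} {r} Q≡1 uq-odd 8∣R =
  subst (+ 8 ∣ₛ_) (sym (expand r v p uq B A N Cq))
    (∣m∣n⇒∣m-n (∣m∣n⇒∣m+n 8∣R (∣n⇒∣m*n (v * p) (odd-square-mod8 uq-odd))) 8∣v[Q-1])
  where
  expand : ∀ r v p uq B A N Cq →
           v * (r - p) ≡ (v * (r - 1ℤ) - uq * v * v * B + v * v * v * A * N * Cq) + v * p * (uq * uq - 1ℤ)
                         - v * ((p * uq * uq - uq * v * B + v * v * A * N * Cq) - 1ℤ)
  expand = solve-∀
  8∣v[Q-1] : + 8 ∣ₛ v * (reducedNorm p uq v A B N Cq - 1ℤ)
  8∣v[Q-1] = subst (λ q → + 8 ∣ₛ v * (q - 1ℤ)) (sym Q≡1) (divides 0ℤ (ℤ.*-zeroʳ v))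

8∣v[r-p]⇒8∣v[Cq-A] : ∀ {A p Cq r v} → + 8 ∣ₛ A * p * Cq - r → IsOdd A → IsOdd p →
                     + 8 ∣ₛ v * (r - p) → + 8 ∣ₛ v * (Cq - A)
8∣v[r-p]⇒8∣v[Cq-A] {A} {p} {Cq} {r} {v} 8∣ApCq-r A-odd p-odd 8∣v[r-p] =
  subst (+ 8 ∣ₛ_) (sym (expand v A p Cq r))
    (∣m∣n⇒∣m+n (∣m∣n⇒∣m+n (∣m∣n⇒∣m+n
      (∣n⇒∣m*n (- (v * Cq)) (odd-square-mod8 (odd-* A-odd p-odd)))
      (∣n⇒∣m*n (A * p * v) 8∣ApCq-r))
      (∣n⇒∣m*n (A * p) 8∣v[r-p]))
      (∣n⇒∣m*n (v * A) (odd-square-mod8 p-odd)))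
  where
  expand : ∀ v A p Cq r → v * (Cq - A) ≡ - (v * Cq) * (A * p * (A * p) - 1ℤ) + A * p * v * (A * p * Cq - r)
                                         + A * p * (v * (r - p)) + v * A * (p * p - 1ℤ)
  expand = solve-∀

8∣v[Cq-A]⇒8∣vX : ∀ {v A Cq uq u′} → + 8 ∣ₛ v * (Cq - A) → IsOdd u′ →
                 + 8 ∣ₛ v * (u′ * Cq + A * (uq * (1ℤ - u′ * u′) - u′))
8∣v[Cq-A]⇒8∣vX {v} {A} {Cq} {uq} {u′} 8∣v[Cq-A] u′-odd =
  subst (+ 8 ∣ₛ_) (sym (expand v A Cq uq u′))
    (∣m∣n⇒∣m-n (∣n⇒∣m*n u′ 8∣v[Cq-A]) (∣n⇒∣m*n (v * A * uq) (odd-square-mod8 u′-odd)))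
  where
  expand : ∀ v A Cq uq u′ → v * (u′ * Cq + A * (uq * (1ℤ - u′ * u′) - u′))
                            ≡ u′ * (v * (Cq - A)) - v * A * uq * (u′ * u′ - 1ℤ)
  expand = solve-∀

8∣R-2∣v : ∀ {r ρ v uq B A N Cq} → r ≡ + 2 * ρ + 1ℤ → IsOdd ρ → + 2 ∣ₛ v → IsOdd uq → IsOdd B →
          + 8 ∣ₛ R r v uq B A N Cq
8∣R-2∣v {ρ = ρ} {uq = uq} {B} {A} {N} {Cq} refl ρ-odd (divides w refl) uq-odd B-odd =
  subst (+ 8 ∣ₛ_) (sym (expand ρ w uq B A N Cq))
    (8∣4x[a+bx]+8y {w} (λ _ → ρ-odd , odd-neg (odd-* uq-odd B-odd)) (w * w * w * A * N * Cq))
  where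
  expand : ∀ ρ w uq B A N Cq →
           (w * + 2) * ((+ 2 * ρ + 1ℤ) - 1ℤ) - uq * (w * + 2) * (w * + 2) * B + (w * + 2) * (w * + 2) * (w * + 2) * A * N * Cq
           ≡ + 4 * (w * (ρ + - (uq * B) * w)) + + 8 * (w * w * w * A * N * Cq)
  expand = solve-∀

8∣R-r≡1-2∥N : ∀ {v uq B A N Cq} → 2 ∥ B → 2 ∥ N → IsOdd uq → IsOdd A → IsOdd Cq →
              + 8 ∣ₛ R 1ℤ v uq B A N Cq
8∣R-r≡1-2∥N {v} {uq} {B} {A} {N} {Cq} 2∥B 2∥N uq-odd A-odd Cq-odd
  with ∥⇒odd-cofactor {2} {B} 2∥B | ∥⇒odd-cofactor {2} {N} 2∥N
... | b , refl , b-odd | n , refl , n-odd =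
  subst (+ 8 ∣ₛ_) (sym (expand v uq b A n Cq))
    (8∣4x[a+bx]+8y {v} (λ v-odd → odd-neg (odd-* (odd-* uq-odd b-odd) v-odd) ,
                                 odd-* (odd-* (odd-* A-odd n-odd) Cq-odd) v-odd) 0ℤ)
  where
  expand : ∀ v uq b A n Cq →
           v * (1ℤ - 1ℤ) - uq * v * v * (+ 4 * b) + v * v * v * A * (+ 4 * n) * Cq
           ≡ + 4 * (v * (- (uq * b * v) + A * n * Cq * v * v)) + + 8 * 0ℤ
  expand = solve-∀

8∣R-r≡1-16∣N : ∀ {v uq B A N Cq} → + 8 ∣ B → + 16 ∣ N → + 8 ∣ₛ R 1ℤ v uq B A N Cq
8∣R-r≡1-16∣N {v} {uq} {B} {A} {N} {Cq} 8∣B 16∣N with ∣ᵤ⇒∣ {+ 8} {B} 8∣B | ∣ᵤ⇒∣ {+ 16} {N} 16∣N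
... | divides e refl | divides n refl = divides (- (uq * v * v * e) + + 2 * v * v * v * A * n * Cq) (expand v uq e A n Cq)
  where
  expand : ∀ v uq e A n Cq →
           v * (1ℤ - 1ℤ) - uq * v * v * (e * + 8) + v * v * v * A * (n * + 16) * Cq
           ≡ (- (uq * v * v * e) + + 2 * v * v * v * A * n * Cq) * + 8
  expand = solve-∀

8∣R-r≡5-16∣N : ∀ {v uq B A N Cq} → 2 ∥ B → + 16 ∣ N → IsOdd uq → + 8 ∣ₛ R (+ 5) v uq B A N Cq
8∣R-r≡5-16∣N {v} {uq} {B} {A} {N} {Cq} 2∥B 16∣N uq-odd with ∥⇒odd-cofactor {2} {B} 2∥B | ∣ᵤ⇒∣ {+ 16} {N} 16∣N
... | b , refl , b-odd | divides n refl =
  subst (+ 8 ∣ₛ_) (sym (expand v uq b A n Cq))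
    (8∣4x[a+bx]+8y {v} (λ _ → (0ℤ , refl) , odd-neg (odd-* uq-odd b-odd)) (+ 2 * v * v * v * A * n * Cq))
  where
  expand : ∀ v uq b A n Cq →
           v * (+ 5 - 1ℤ) - uq * v * v * (+ 4 * b) + v * v * v * A * (n * + 16) * Cq
           ≡ + 4 * (v * (1ℤ + - (uq * b) * v)) + + 8 * (+ 2 * v * v * v * A * n * Cq)
  expand = solve-∀

8∣R-r≡5-2∥N : ∀ {v uq B A N Cq} → + 8 ∣ B → 2 ∥ N → IsOdd A → IsOdd Cq → + 8 ∣ₛ R (+ 5) v uq B A N Cq
8∣R-r≡5-2∥N {v} {uq} {B} {A} {N} {Cq} 8∣B 2∥N A-odd Cq-odd with ∣ᵤ⇒∣ {+ 8} {B} 8∣B | ∥⇒odd-cofactor {2} {N} 2∥N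
... | divides e refl | n , refl , n-odd =
  subst (+ 8 ∣ₛ_) (sym (expand v uq e A n Cq))
    (8∣4x[a+bx]+8y {v} (λ v-odd → (0ℤ , refl) , odd-* (odd-* (odd-* v-odd A-odd) n-odd) Cq-odd) (- (uq * v * v * e)))
  where
  expand : ∀ v uq e A n Cq →
           v * (+ 5 - 1ℤ) - uq * v * v * (e * + 8) + v * v * v * A * (+ 4 * n) * Cq
           ≡ + 4 * (v * (1ℤ + v * A * n * Cq * v)) + + 8 * - (uq * v * v * e)
  expand = solve-∀

D≡1-mod8⇒B-odd : ∀ {A B C D} → B * B - + 4 * A * C ≡ D → D ≡ 1ℤ [mod + 8 ] → IsOdd B
D≡1-mod8⇒B-odd {A} {B} {C} refl 8∣D-1 =
  odd-*ˡ {B} {B} (odd-≡-mod2 {B * B} (subst (+ 2 ∣ₛ_) (regroup B A C) 2∣[D-1]+4AC) (0ℤ , refl))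
  where
  regroup : ∀ B A C → (B * B - + 4 * A * C - 1ℤ) + + 4 * A * C ≡ B * B - 1ℤ
  regroup = solve-∀
  2∣[D-1]+4AC : + 2 ∣ₛ (B * B - + 4 * A * C - 1ℤ) + + 4 * A * C
  2∣[D-1]+4AC = ∣m∣n⇒∣m+n (∣-trans (divides (+ 4) refl) (∣ᵤ⇒∣ {+ 8} {B * B - + 4 * A * C - 1ℤ} 8∣D-1))
                          (∣m⇒∣m*n C (∣m⇒∣m*n A (divides (+ 2) refl)))

r≡3∨7⇒r≡2ρ+1 : ∀ {r} → r ≡ 3 ⊎ r ≡ 7 → ∃[ ρ ] + r ≡ + 2 * ρ + 1ℤ × IsOdd ρ
r≡3∨7⇒r≡2ρ+1 (inj₁ refl) = 1ℤ , refl , 0ℤ , refl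
r≡3∨7⇒r≡2ρ+1 (inj₂ refl) = + 3 , refl , 1ℤ , refl

8∣R-r≡3∨7 : ∀ {N : ℕ} {B A C D p uq v Cq : ℤ} {r : ℕ} →
      B * B - + 4 * A * C ≡ D → reducedNorm p uq v A B (+ N) Cq ≡ 1ℤ → + 2 ∣ₛ + N →
      IsOdd p → IsOdd uq → (r ≡ 3 ⊎ r ≡ 7) × D ≡ 1ℤ [mod + 8 ] →
      + 8 ∣ₛ R (+ r) v uq B A (+ N) Cq
8∣R-r≡3∨7 {N} {B} {A} {C} {D} {p} {uq} {v} {Cq} B²-4AC≡D Q≡1 2∣N p-odd uq-odd (r≡3∨7 , D≡1)
  with r≡3∨7⇒r≡2ρ+1 r≡3∨7
... | ρ , r≡2ρ+1 , ρ-odd =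
  8∣R-2∣v r≡2ρ+1 ρ-odd (reducedNorm≡1⇒2∣v {p} {uq} {v} {A} {B} {+ N} {Cq} Q≡1 2∣N p-odd B-odd) uq-odd B-odd
  where
  B-odd : IsOdd B
  B-odd = D≡1-mod8⇒B-odd {A} {B} {C} {D} B²-4AC≡D D≡1

8∣R-r≡1 : ∀ {N : ℕ} {B A D uq v Cq : ℤ} {r : ℕ} →
      B * B ≡ D + + 4 * + r * + N [mod + (32 ℕ.* N) ] → 2 ∥ + N ⊎ + 16 ∣ + N →
      IsOdd A → IsOdd Cq → IsOdd uq → r ≡ 1 × + 32 ∣ D →
      + 8 ∣ₛ R (+ r) v uq B A (+ N) Cq
8∣R-r≡1 {N} {B} {A} {D} {uq} {v} {Cq} B²≡D+4N (inj₁ 2∥N) A-odd Cq-odd uq-odd (refl , 32∣D) =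
  8∣R-r≡1-2∥N {v} {uq} {B} {A} {+ N} {Cq} (proj₁ (B-shape-r≡1 {N} {B} {D} B²≡D+4N (refl , 32∣D)) 2∥N) 2∥N uq-odd A-odd Cq-odd
8∣R-r≡1 {N} {B} {A} {D} {uq} {v} {Cq} B²≡D+4N (inj₂ 16∣N) A-odd Cq-odd uq-odd (refl , 32∣D) =
  8∣R-r≡1-16∣N {v} {uq} {B} {A} {+ N} {Cq} (proj₂ (B-shape-r≡1 {N} {B} {D} B²≡D+4N (refl , 32∣D)) 16∣N) 16∣N

8∣R-r≡5 : ∀ {N : ℕ} {B A D uq v Cq : ℤ} {r : ℕ} →
      B * B ≡ D + + 4 * + r * + N [mod + (32 ℕ.* N) ] → 2 ∥ + N ⊎ + 16 ∣ + N →
      IsOdd A → IsOdd Cq → IsOdd uq → r ≡ 5 × 4 ∥ D →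
      + 8 ∣ₛ R (+ r) v uq B A (+ N) Cq
8∣R-r≡5 {N} {B} {A} {D} {uq} {v} {Cq} B²≡D+20N (inj₁ 2∥N) A-odd Cq-odd uq-odd (refl , 4∥D) =
  8∣R-r≡5-2∥N {v} {uq} {B} {A} {+ N} {Cq} (proj₂ (B-shape-r≡5 {N} {B} {D} B²≡D+20N (refl , 4∥D)) 2∥N) 2∥N A-odd Cq-odd
8∣R-r≡5 {N} {B} {A} {D} {uq} {v} {Cq} B²≡D+20N (inj₂ 16∣N) A-odd Cq-odd uq-odd (refl , 4∥D) =
  8∣R-r≡5-16∣N {v} {uq} {B} {A} {+ N} {Cq} (proj₁ (B-shape-r≡5 {N} {B} {D} B²≡D+20N (refl , 4∥D)) 16∣N) 16∣N uq-odd

8∣R-by-cases : ∀ {N : ℕ} {B A C D p uq v Cq : ℤ} {r : ℕ} →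
      B * B - + 4 * A * C ≡ D → B * B ≡ D + + 4 * + r * + N [mod + (32 ℕ.* N) ] →
      2 ∥ + N ⊎ + 16 ∣ + N → reducedNorm p uq v A B (+ N) Cq ≡ 1ℤ → + 2 ∣ₛ + N →
      IsOdd p → IsOdd A → IsOdd Cq → IsOdd uq →
      ((r ≡ 3 ⊎ r ≡ 7) × D ≡ 1ℤ [mod + 8 ]) ⊎ (r ≡ 1 × + 32 ∣ D) ⊎ (r ≡ 5 × 4 ∥ D) →
      + 8 ∣ₛ R (+ r) v uq B A (+ N) Cq
8∣R-by-cases {N} {B} {A} {C} {D} {p} {uq} {v} {Cq} B²-4AC≡D _ _ Q≡1 2∣N p-odd _ _ uq-odd (inj₁ case-a) =
  8∣R-r≡3∨7 {N} {B} {A} {C} {D} {p} {uq} {v} {Cq} B²-4AC≡D Q≡1 2∣N p-odd uq-odd case-a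
8∣R-by-cases {N} {B} {A} {C} {D} {p} {uq} {v} {Cq} _ B²≡D+4rN N-shape _ _ _ A-odd Cq-odd uq-odd (inj₂ (inj₁ case-b)) =
  8∣R-r≡1 {N} {B} {A} {D} {uq} {v} {Cq} B²≡D+4rN N-shape A-odd Cq-odd uq-odd case-b
8∣R-by-cases {N} {B} {A} {C} {D} {p} {uq} {v} {Cq} _ B²≡D+4rN N-shape _ _ _ A-odd Cq-odd uq-odd (inj₂ (inj₂ case-c)) =
  8∣R-r≡5 {N} {B} {A} {D} {uq} {v} {Cq} B²≡D+4rN N-shape A-odd Cq-odd uq-odd case-c

8∣t : ∀ {j t y} → + 2 * t ≡ + 3 * + (2 ℕ.* j) * y → + 8 ∣ₛ y → + 8 ∣ₛ t
8∣t {j} {t} {y} 2t≡3·2j·y 8∣y = subst (+ 8 ∣ₛ_) (sym t≡3jy) (∣n⇒∣m*n (+ 3 * + j) 8∣y)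
  where
  open ≡-Reasoning
  regroup : ∀ j y → + 3 * (+ 2 * j) * y ≡ + 2 * (+ 3 * j * y)
  regroup = solve-∀
  t≡3jy : t ≡ + 3 * + j * y
  t≡3jy = ℤ.*-cancelˡ-≡ (+ 2) t (+ 3 * + j * y) (begin
    + 2 * t                  ≡⟨ 2t≡3·2j·y ⟩
    + 3 * + (2 ℕ.* j) * y    ≡⟨ cong (λ x → + 3 * x * y) (ℤ.pos-* 2 j) ⟩
    + 3 * (+ 2 * + j) * y    ≡⟨ regroup (+ j) y ⟩
    + 2 * (+ 3 * + j * y)    ∎)

r≡1∨3∨5∨7⇒odd : ∀ {r} → r ≡ 1 ⊎ r ≡ 3 ⊎ r ≡ 5 ⊎ r ≡ 7 → IsOdd (+ r)
r≡1∨3∨5∨7⇒odd (inj₁ refl) = 0ℤ , refl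
r≡1∨3∨5∨7⇒odd (inj₂ (inj₁ refl)) = 1ℤ , refl
r≡1∨3∨5∨7⇒odd (inj₂ (inj₂ (inj₁ refl))) = + 2 , refl
r≡1∨3∨5∨7⇒odd (inj₂ (inj₂ (inj₂ refl))) = + 3 , refl

8∣θ : ∀ {N λN N₁ m p r : ℕ} {A B C D u v v₁ A₁ Cq uq t : ℤ} .{{_ : ℕ.NonZero N}} .{{_ : ℕ.NonZero p}} →
      IsTwoAdicDecomp N λN N₁ → N ≡ m ℕ.* m → + 2 ∣ + N →
      B * B - + 4 * A * C ≡ D → + p ≡ u * u - u * v * B + v * v * A * C →
      r ≡ 1 ⊎ r ≡ 3 ⊎ r ≡ 5 ⊎ r ≡ 7 → B * B ≡ D + + 4 * + r * + N [mod + (32 ℕ.* N) ] →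
      C ≡ + N * + p * Cq → u ≡ + p * uq → + 2 * t ≡ + 3 * + λN * ((u - v * B) * (u - v * B) - 1ℤ) →
      ((r ≡ 3 ⊎ r ≡ 7) × D ≡ 1ℤ [mod + 8 ]) ⊎ (r ≡ 1 × + 32 ∣ D) ⊎ (r ≡ 5 × 4 ∥ D) →
      + 8 ∣ θ N λN A B C u v v₁ A₁ (+ N₁) Cq uq t
8∣θ {N} {λN} {N₁} {m} {p} {r} {A} {B} {_} {_} {_} {v} {v₁} {A₁} {Cq} {uq} {t}
    decomp N≡m² 2∣N B²-4AC≡D@refl p≡norm r-odd B²≡D+4rN refl refl 2t≡3λ[u′²-1] case
  with square-twoAdicDecomp {N} {λN} {N₁} {m} decomp N≡m²
... | (j , refl) , 8∣N₁-1 =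
  ∣⇒∣ᵤ (∣m∣n⇒∣m+n (∣m∣n⇒∣m+n 8∣[N-1]vX 8∣3v₁A₁[N₁-1][u′-1]) (8∣t {j} {t} 2t≡3λ[u′²-1] (odd-square-mod8 u′-odd)))
  where
  u′ : ℤ
  u′ = + p * uq - v * B
  X : ℤ
  X = u′ * Cq + A * (uq * (1ℤ - u′ * u′) - u′)
  Q≡1 : reducedNorm (+ p) uq v A B (+ N) Cq ≡ 1ℤ
  Q≡1 = norm≡p⇒reducedNorm≡1 {uq} {v} {A} {B} {+ N} {Cq} (+ p) p≡norm
  2∣N′ : + 2 ∣ₛ + N
  2∣N′ = ∣ᵤ⇒∣ {+ 2} {+ N} 2∣N
  8∣ApCq-r : + 8 ∣ₛ A * + p * Cq - + r
  8∣ApCq-r = ApCq≡r-mod8 {A} {B} {+ p} {+ r} {Cq} (+ N) (≡-mod-m*n⇒∣ {B * B} 32 N B²≡D+4rN)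
  ApCq-odd : IsOdd (A * + p * Cq)
  ApCq-odd = odd-≡-mod2 {A * + p * Cq} {+ r} (∣-trans (divides (+ 4) refl) 8∣ApCq-r) (r≡1∨3∨5∨7⇒odd r-odd)
  uq·u′-odd : IsOdd (uq * u′)
  uq·u′-odd = reducedNorm≡1⇒odd {+ p} {uq} {v} {A} {B} {+ N} {Cq} Q≡1 2∣N′
  uq-odd : IsOdd uq
  uq-odd = odd-*ˡ {uq} {u′} uq·u′-odd
  u′-odd : IsOdd u′
  u′-odd = odd-*ʳ {uq} {u′} uq·u′-odd
  A-odd : IsOdd A
  A-odd = odd-*ˡ {A} {+ p} (odd-*ˡ {A * + p} {Cq} ApCq-odd)
  p-odd : IsOdd (+ p)
  p-odd = odd-*ʳ {A} {+ p} (odd-*ˡ {A * + p} {Cq} ApCq-odd)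
  Cq-odd : IsOdd Cq
  Cq-odd = odd-*ʳ {A * + p} {Cq} ApCq-odd
  8∣R : + 8 ∣ₛ R (+ r) v uq B A (+ N) Cq
  8∣R = 8∣R-by-cases {N} {B} {A} {+ N * + p * Cq} {B * B - + 4 * A * (+ N * + p * Cq)} {+ p} {uq} {v} {Cq} {r}
          refl B²≡D+4rN (evenSquare-2∥⊎16∣ {N} {λN} {N₁} {m} decomp N≡m² 2∣N) Q≡1 2∣N′
          p-odd A-odd Cq-odd uq-odd case
  8∣vX : + 8 ∣ₛ v * X
  8∣vX = 8∣v[Cq-A]⇒8∣vX {v} {A} {Cq} {uq} {u′}
    (8∣v[r-p]⇒8∣v[Cq-A] {A} {+ p} {Cq} {+ r} {v} 8∣ApCq-r A-odd p-odd
      (8∣R⇒8∣v[r-p] {+ p} {uq} {v} {A} {B} {+ N} {Cq} {+ r} Q≡1 uq-odd 8∣R)) u′-odd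
  8∣[N-1]vX : + 8 ∣ₛ (+ N - 1ℤ) * v * X
  8∣[N-1]vX = subst (+ 8 ∣ₛ_) (sym (ℤ.*-assoc (+ N - 1ℤ) v X)) (∣n⇒∣m*n (+ N - 1ℤ) 8∣vX)
  8∣3v₁A₁[N₁-1][u′-1] : + 8 ∣ₛ + 3 * v₁ * A₁ * (+ N₁ - 1ℤ) * (u′ - 1ℤ)
  8∣3v₁A₁[N₁-1][u′-1] = ∣m⇒∣m*n (u′ - 1ℤ) (∣n⇒∣m*n (+ 3 * v₁ * A₁) 8∣N₁-1)

mainTheorem12 : ∀ (N λN N₁ : ℕ) (c : ℕ) (Δ D A B C u v v₁ A₁ : ℤ) (p : ℕ) (r : ℕ) →
    -- N > 1, N = 2^λ(N) N₁ with N₁ odd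
    1 ℕ.< N → IsTwoAdicDecomp N λN N₁ →
    -- D = c²Δ < 0, Δ fundamental, c ≥ 1
    1 ℕ.≤ c → FundamentalDiscriminant Δ → D ≡ + (c ℕ.* c) * Δ → D < 0ℤ →
    -- [A,B,C] primitive positive definite with discriminant D
    gcd (gcd A B) C ≡ 1ℤ → 0ℤ < A → B * B - + 4 * A * C ≡ D →
    gcd A (+ N) ≡ 1ℤ → + N ∣ C →
    -- p = u² - uvB + v²AC prime, p ∤ 6cN, p splits in O, p ∣ C, p ∣ u
    Prime p → + p ≡ u * u - u * v * B + v * v * A * C →
    ¬ (+ p ∣ + (6 ℕ.* c ℕ.* N)) → SplitsIn p D →
    + p ∣ C → + p ∣ u →
    -- odd parts
    IsOddPart v v₁ → IsOddPart A A₁ →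
    -- N an even square
    (∃ λ m → N ≡ m ℕ.* m) → + 2 ∣ + N →
    -- r ∈ {1,3,5,7}, B² ≡ D + 4rN (mod 32N)
    (r ≡ 1 ⊎ r ≡ 3 ⊎ r ≡ 5 ⊎ r ≡ 7) →
    B * B ≡ D + + 4 * + r * + N [mod + (32 ℕ.* N) ] →
    -- conclusion: for the integers Cq = C/(Np), uq = u/p, t = 3λ(N)(u'²-1)/2
    (∀ (Cq uq t : ℤ) → C ≡ + N * + p * Cq → u ≡ + p * uq →
       + 2 * t ≡ + 3 * + λN * ((u - v * B) * (u - v * B) - 1ℤ) →
       (((r ≡ 3 ⊎ r ≡ 7) × D ≡ 1ℤ [mod + 8 ])
         ⊎ (r ≡ 1 × + 32 ∣ D)
         ⊎ (r ≡ 5 × 4 ∥ D)) →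
       + 8 ∣ θ N λN A B C u v v₁ A₁ (+ N₁) Cq uq t)
    × ((r ≡ 1 × + 32 ∣ D) →
         (2 ∥ + N → 2 ∥ B) × (+ 16 ∣ + N → + 8 ∣ B))
    × ((r ≡ 5 × 4 ∥ D) →
         (+ 16 ∣ + N → 2 ∥ B) × (2 ∥ + N → + 8 ∣ B))
mainTheorem12 N λN N₁ c Δ D A B C u v v₁ A₁ p r 1<N decomp _ _ _ _ _ _ B²-4AC≡D _ _ p-prime p≡norm _ _ _ _ _ _
  (m , N≡m²) 2∣N r-odd B²≡D+4rN =
    (λ Cq uq t C≡NpCq u≡puq 2t≡3λ[u′²-1] case →
      8∣θ {N} {λN} {N₁} {m} {p} {r} {A} {B} {C} {D} {u} {v} {v₁} {A₁} {Cq} {uq} {t} {{N≢0}} {{p≢0}}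
        decomp N≡m² 2∣N B²-4AC≡D p≡norm r-odd B²≡D+4rN C≡NpCq u≡puq 2t≡3λ[u′²-1] case) ,
    B-shape-r≡1 {N} {B} {D} {r} B²≡D+4rN ,
    B-shape-r≡5 {N} {B} {D} {r} B²≡D+4rN
  where
  N≢0 : ℕ.NonZero N
  N≢0 = ℕ.>-nonZero (ℕP.<-trans (ℕ.s≤s ℕ.z≤n) 1<N)
  p≢0 : ℕ.NonZero p
  p≢0 = prime⇒nonZero p-prime
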